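{- Let $c \in \mathbb{Z}^d$, $\lambda \in \mathbb{Z}$, and $\tilde w = \text{Dual-Greedy}(c,\lambda)$. Assume that $\tilde w$ has exactly $k$ active constraints. Then every optimal support $S^\star \in \mathrm{ProjLagr}(\lambda - \varepsilon, c)$, for $0 < \varepsilon < 1/d$, has cardinality exactly $k$.
   Context: $\Delta, k$ are positive integers; $[d] = \{1,\dots,d\}$; for $\Omega\subseteq[d]$, $\mathrm{sep}(\Omega)=\min_{i\ne j\in\Omega}|i-j|$, $\mathbb{M}_\Delta = \{\Omega\subseteq[d] : \mathrm{sep}(\Omega)\ge\Delta\}$. $\mathrm{ProjLagr}(\mu,a) := \arg\max_{S \in \mathbb{M}_\Delta} \left(\sum_{i\in S}a_i + \mu(k - |S|)\right)$. Dual-Greedy$(c,\lambda)$ returns the vector $w$ with $w_0 = \lambda$ and, for $i = 1,\dots,d$ in increasing order, $w_i = \max\{0,\ c_i - (w_0 + \sum_{j=\max\{1,i-\Delta+1\}}^{i-1} w_j)\}$. Active constraints: for $w = \text{Dual-Greedy}(c,\lambda)$ with $\lambda \in \mathbb{Z}$ and $w' = \text{Dual-Greedy}(c,\lambda - \varepsilon')$ for a fixed small $\varepsilon' \in (0,1)$, the active constraints of $w$ are the indices $i \in [d]$ with $w'_i = w_i + \varepsilon'$.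
   Formalization: The perturbation ε in $\mathrm{ProjLagr}(\lambda - \varepsilon, c)$ takes rational values, as do the perturbation ε′ defining the active constraints and the values computed by Dual-Greedy. -}

module Defs where

open import Data.Nat as ℕ using (ℕ; _∸_)
open import Data.Integer as ℤ using (ℤ)
open import Data.Rational as ℚ using (ℚ; 0ℚ; _+_; _-_; _*_; _⊔_; _≤_)
open import Data.Rational.Properties using (_≟_)
open import Data.Fin using (Fin; toℕ)
open import Data.Fin.Subset using (Subset; _∈_; ∣_∣)
open import Data.Product using (_×_)
open import Data.Bool using (Bool; true; false)
open import Data.List as List using (List; []; _∷_; take; foldr; filter; length; allFin)
open import Data.Vec as Vec using (Vec; []; _∷_; lookup)
open import Relation.Binary.PropositionalEquality using (_≡_; _≢_)

sumℚ : List ℚ → ℚ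
sumℚ = foldr _+_ 0ℚ

-- Core loop of Dual-Greedy.  `h` is the list of already computed
-- w_{i-1}, w_{i-2}, ..., w_1 (most recent first).  The window
-- j ∈ {max(1,i-Δ+1), ..., i-1} consists of the (at most) Δ-1 most
-- recent entries, i.e. `take (Δ ∸ 1) h`.
greedyGo : (Δ : ℕ) (λ₀ : ℚ) → List ℚ → {n : ℕ} → Vec ℚ n → Vec ℚ n
greedyGo Δ λ₀ h [] = []
greedyGo Δ λ₀ h (ci ∷ cs) =
  let wi = 0ℚ ⊔ (ci - (λ₀ + sumℚ (take (Δ ∸ 1) h)))
  in wi ∷ greedyGo Δ λ₀ (wi ∷ h) cs

-- Dual-Greedy(c, λ): returns (w_1, ..., w_d) (coordinate i of [d] is the
-- Fin d index i-1); the coordinate w_0 is λ itself.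
DualGreedy : (Δ : ℕ) {d : ℕ} → Vec ℤ d → ℚ → Vec ℚ d
DualGreedy Δ c λ₀ = greedyGo Δ λ₀ [] (Vec.map (λ z → z ℚ./ 1) c)

-- Number of active constraints of w = Dual-Greedy(c, λ) computed with
-- perturbation ε': indices i with w'_i = w_i + ε' where
-- w' = Dual-Greedy(c, λ - ε').
activeCount : (Δ : ℕ) {d : ℕ} → Vec ℤ d → ℚ → ℚ → ℕ
activeCount Δ {d} c λ₀ ε′ =
  length (filter (λ i → lookup w′ i ≟ (lookup w i + ε′)) (allFin d))
  where
    w  = DualGreedy Δ c λ₀
    w′ = DualGreedy Δ c (λ₀ - ε′)

dist : ℕ → ℕ → ℕ
dist m n = ℕ.∣ m - n ∣

-- Ω ∈ 𝕄_Δ : sep(Ω) ≥ Δ, i.e. distinct elements of Ω are at distance ≥ Δ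
-- (vacuous when |Ω| ≤ 1, matching min ∅ = ∞).
InM : (Δ : ℕ) {d : ℕ} → Subset d → Set
InM Δ {d} Ω = (i j : Fin d) → i ∈ Ω → j ∈ Ω → i ≢ j → Δ ℕ.≤ dist (toℕ i) (toℕ j)

sumOn : {d : ℕ} → Subset d → Vec ℤ d → ℤ
sumOn [] [] = ℤ.+ 0
sumOn (true ∷ S) (a ∷ as) = a ℤ.+ sumOn S as
sumOn (false ∷ S) (a ∷ as) = sumOn S as

lagr : (k : ℕ) {d : ℕ} → ℚ → Vec ℤ d → Subset d → ℚ
lagr k μ a S = (sumOn S a ℚ./ 1) + μ * ((ℤ.+ k ℤ.- ℤ.+ ∣ S ∣) ℚ./ 1)

InProjLagr : (Δ k : ℕ) {d : ℕ} → ℚ → Vec ℤ d → Subset d → Set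
InProjLagr Δ k {d} μ a S =
  InM Δ S × ((T : Subset d) → InM Δ T → lagr k μ a T ≤ lagr k μ a S)

-- Write gain μ T = Σ_{i∈T} (c_i - μ); the Lagrangian is gain μ T + μk, and
-- separated supports (𝕄_Δ) are described recursively by `Separated`.  The
-- proof is an LP-duality squeeze:
--   * weak/strong duality: the total D(μ) of the greedy's output bounds the
--     gain of every separated support and is attained by one of them;
--   * perturbation: for integral L and 0 < e < 1 the greedy at L - e raises
--     each coordinate by 0 or e, so D(L - e) = D(L) + e·#active and D(L) ∈ ℤ;
--   * squeeze (module Squeeze, stated abstractly): gains at L are integral and
--     gain (L - t) T = gain L T + t|T|; with t|T| < 1 a maximiser at L - ε
--     must attain D(L) at L, which forces |S| ≥ k, while weak duality at
--     L - e with e = εδ forces |S| ≤ k.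

module Submission where

open import Defs
open import Data.Nat as ℕ using (ℕ; zero; suc; _∸_; NonZero; _≥_)
open import Data.Integer as ℤ using (ℤ; +_; -[1+_])
import Data.Integer.Properties as ℤP
open import Data.Rational
  using (ℚ; mkℚ; 0ℚ; 1ℚ; _+_; _-_; _*_; -_; _≤_; _<_; _/_; _⊔_; 1/_; ↥_; *≤*; *<*; positive; nonNegative)
open import Data.Rational.Properties
open import Data.Rational.Solver using (module +-*-Solver)
open +-*-Solver using (solve; _:+_; _:-_; _:*_; :-_; _:=_; con)
open import Data.Nat.Coprimality as Coprimality using ()
open import Relation.Binary.PropositionalEquality
open import Data.Bool using (Bool; true; false; not; _∨_; if_then_else_)
open import Data.Unit using (⊤; tt)
open import Data.Empty using (⊥; ⊥-elim)
open import Data.Product using (Σ; _×_; _,_; proj₁; proj₂)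
open import Data.Sum using (_⊎_; inj₁; inj₂)
open import Data.List as List using (List; []; _∷_; take; length; filter)
open import Data.Vec as Vec using (Vec; []; _∷_; lookup)
open import Data.Vec.Relation.Unary.All using (All; []; _∷_)
import Data.Nat.Properties as ℕP
open import Data.Fin using (Fin; zero; suc; toℕ)
import Data.Fin.Properties as FinP
open import Data.Fin.Subset using (Subset; _∈_; ∣_∣)
open import Data.Vec.Base using (here; there)
open import Relation.Nullary using (does; yes; no)
open import Relation.Unary using (Decidable)
open import Data.Fin.Subset.Properties using (∣p∣≤n)

ι : ℤ → ℚ
ι x = mkℚ x 0 (Coprimality.sym (Coprimality.1-coprimeTo _))

/1≡ι : ∀ x → x / 1 ≡ ι x
/1≡ι x = ↥p/↧p≡p (ι x)

0ℚ≡ι0 : 0ℚ ≡ ι (+ 0)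
0ℚ≡ι0 = /1≡ι (+ 0)

1ℚ≡ι1 : 1ℚ ≡ ι (+ 1)
1ℚ≡ι1 = /1≡ι (+ 1)

ι-+ : ∀ x y → ι x + ι y ≡ ι (x ℤ.+ y)
ι-+ x y = trans (cong (_/ 1) (cong₂ ℤ._+_ (ℤP.*-identityʳ x) (ℤP.*-identityʳ y))) (/1≡ι (x ℤ.+ y))

ι-neg : ∀ x → - ι x ≡ ι (ℤ.- x)
ι-neg (+ zero) = refl
ι-neg (+ suc n) = refl
ι-neg -[1+ n ] = refl

ι-- : ∀ x y → ι (x ℤ.- y) ≡ ι x - ι y
ι-- x y = trans (sym (ι-+ x (ℤ.- y))) (cong (λ z → ι x + z) (sym (ι-neg y)))

ι-suc : ∀ n → ι (+ suc n) ≡ 1ℚ + ι (+ n)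
ι-suc n = trans (sym (ι-+ (+ 1) (+ n))) (cong (_+ ι (+ n)) (sym 1ℚ≡ι1))

ι-mono-≤ : ∀ {x y} → x ℤ.≤ y → ι x ≤ ι y
ι-mono-≤ {x} {y} p = *≤* (subst₂ ℤ._≤_ (sym (ℤP.*-identityʳ x)) (sym (ℤP.*-identityʳ y)) p)

ι-cancel-< : ∀ {x y} → ι x < ι y → x ℤ.< y
ι-cancel-< {x} {y} (*<* p) = subst₂ ℤ._<_ (ℤP.*-identityʳ x) (ℤP.*-identityʳ y) p

ι-nonNeg : ∀ n → 0ℚ ≤ ι (+ n)
ι-nonNeg n = subst (_≤ ι (+ n)) (sym 0ℚ≡ι0) (ι-mono-≤ (ℤ.+≤+ ℕ.z≤n))

0≡0+t*ι0 : ∀ t → 0ℚ ≡ 0ℚ + t * ι (+ 0)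
0≡0+t*ι0 t = begin
  0ℚ                 ≡⟨ solve 1 (λ t → con 0ℚ := con 0ℚ :+ t :* con 0ℚ) refl t ⟩
  0ℚ + t * 0ℚ        ≡⟨ cong (λ z → 0ℚ + t * z) 0ℚ≡ι0 ⟩
  0ℚ + t * ι (+ 0)   ∎
  where open ≡-Reasoning

IsInt : ℚ → Set
IsInt q = Σ ℤ (λ z → q ≡ ι z)

isInt-+ : ∀ {x y} → IsInt x → IsInt y → IsInt (x + y)
isInt-+ (a , refl) (b , refl) = a ℤ.+ b , ι-+ a b

isInt-- : ∀ {x y} → IsInt x → IsInt y → IsInt (x - y)
isInt-- (a , refl) (b , refl) = a ℤ.- b , sym (ι-- a b)

+-cancelˡ-≤ : ∀ a {x y} → a + x ≤ a + y → x ≤ y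
+-cancelˡ-≤ a {x} {y} p = subst₂ _≤_ (cancel x) (cancel y) (+-monoʳ-≤ (- a) p)
  where
    cancel : ∀ z → (- a) + (a + z) ≡ z
    cancel z = solve 2 (λ a z → (:- a) :+ (a :+ z) := z) refl a z

≤-+-nonNeg : ∀ a {r} → 0ℚ ≤ r → a ≤ a + r
≤-+-nonNeg a {r} p = subst (_≤ a + r) (+-identityʳ a) (+-monoʳ-≤ a p)

+*-cancel-≤ : ∀ a {t x y} → 0ℚ < t → a + t * x ≤ a + t * y → x ≤ y
+*-cancel-≤ a {t} 0<t le = *-cancelˡ-≤-pos t {{positive 0<t}} (+-cancelˡ-≤ a le)

*-nonNeg : ∀ {t q} → 0ℚ < t → 0ℚ ≤ q → 0ℚ ≤ t * q
*-nonNeg {t} 0<t 0≤q = subst (_≤ t * _) (*-zeroʳ t) (*-monoˡ-≤-nonNeg t {{nonNegative (<⇒≤ 0<t)}} 0≤q)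

int-gap : ∀ v g → ι v < ι g → 1ℚ + ι v ≤ ι g
int-gap v g v<g =
  subst (_≤ ι g) (trans (sym (ι-+ (+ 1) v)) (cong (_+ ι v) (sym 1ℚ≡ι1)))
        (ι-mono-≤ (ℤP.i<j⇒suc[i]≤j (ι-cancel-< v<g)))

int-floor : ∀ {G V r} → IsInt G → IsInt V → r < 1ℚ → G ≤ V + r → G ≤ V
int-floor {G} {V} {r} (g , refl) (v , refl) r<1 G≤V+r with G ≤? V
... | yes G≤V = G≤V
... | no G≰V = ⊥-elim (<-irrefl refl (begin-strict
      V + 1ℚ  ≡⟨ +-comm V 1ℚ ⟩
      1ℚ + V  ≤⟨ int-gap v g (≰⇒> G≰V) ⟩
      G       ≤⟨ G≤V+r ⟩
      V + r   <⟨ +-monoʳ-< V r<1 ⟩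
      V + 1ℚ  ∎))
  where open ≤-Reasoning

-- Weak and strong duality for the greedy.

total : ∀ {n} → Vec ℚ n → ℚ
total [] = 0ℚ
total (x ∷ xs) = x + total xs

gain : ∀ {n} → ℚ → Subset n → Vec ℚ n → ℚ
gain μ [] [] = 0ℚ
gain μ (true ∷ T) (x ∷ xs) = (x - μ) + gain μ T xs
gain μ (false ∷ T) (x ∷ xs) = gain μ T xs

Clear : ∀ {n} → ℕ → Subset n → Set
Clear zero _ = ⊤
Clear (suc m) [] = ⊤
Clear (suc m) (true ∷ T) = ⊥
Clear (suc m) (false ∷ T) = Clear m T

-- Separated Δ T: every selected position is followed by Δ - 1 unselected ones,
-- the recursive form of membership in 𝕄_Δ.
Separated : ∀ {n} → ℕ → Subset n → Set
Separated Δ [] = ⊤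
Separated Δ (true ∷ T) = Clear (Δ ∸ 1) T × Separated Δ T
Separated Δ (false ∷ T) = Separated Δ T

window : ℕ → List ℚ → ℚ
window Δ h = sumℚ (take (Δ ∸ 1) h)

next : ℕ → ℚ → List ℚ → ℚ → ℚ
next Δ μ h x = 0ℚ ⊔ (x - (μ + window Δ h))

-- carry m h T: the part of the history h (restricted to its m most recent
-- entries) that still lies in the window of the first selected position of T.
carry : ∀ {n} → ℕ → List ℚ → Subset n → ℚ
carry m h [] = 0ℚ
carry m h (true ∷ T) = sumℚ (take m h)
carry m h (false ∷ T) = carry (m ∸ 1) h T

clear⇒carry≡0 : ∀ {n} m h (T : Subset n) → Clear m T → carry m h T ≡ 0ℚ
clear⇒carry≡0 m h [] _ = refl
clear⇒carry≡0 zero h (true ∷ T) _ = refl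
clear⇒carry≡0 zero h (false ∷ T) _ = clear⇒carry≡0 zero h T tt
clear⇒carry≡0 (suc m) h (false ∷ T) cl = clear⇒carry≡0 m h T cl

clear-pred : ∀ {n} m (T : Subset n) → Clear m T → Clear (m ∸ 1) T
clear-pred zero T _ = tt
clear-pred (suc zero) T _ = tt
clear-pred (suc (suc m)) [] _ = tt
clear-pred (suc (suc m)) (false ∷ T) cl = clear-pred (suc m) T cl

carry-[] : ∀ {n} m (T : Subset n) → carry m [] T ≡ 0ℚ
carry-[] m [] = refl
carry-[] zero (true ∷ T) = refl
carry-[] (suc m) (true ∷ T) = refl
carry-[] m (false ∷ T) = carry-[] (m ∸ 1) T

carry-push : ∀ {n} m w h (T : Subset n) →
  (Clear m T × (∀ h′ → carry m h′ T ≡ 0ℚ)) ⊎ (carry m (w ∷ h) T ≡ w + carry (m ∸ 1) h T)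
carry-push m w h [] = inj₁ (clear-[] m , λ _ → refl)
  where
    clear-[] : ∀ m → Clear m []
    clear-[] zero = tt
    clear-[] (suc m) = tt
carry-push zero w h (true ∷ T) = inj₁ (tt , λ _ → refl)
carry-push (suc m) w h (true ∷ T) = inj₂ refl
carry-push zero w h (false ∷ T) = inj₁ (tt , λ h′ → clear⇒carry≡0 zero h′ T tt)
carry-push (suc m) w h (false ∷ T) = carry-push m w h T

carry-push-≤ : ∀ {n} m w h (T : Subset n) → 0ℚ ≤ w → carry m (w ∷ h) T ≤ w + carry (m ∸ 1) h T
carry-push-≤ m w h T 0≤w with carry-push m w h T
... | inj₂ eq = ≤-reflexive eq
... | inj₁ (cl , carry≡0) = begin
  carry m (w ∷ h) T        ≡⟨ carry≡0 (w ∷ h) ⟩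
  0ℚ                       ≤⟨ 0≤w ⟩
  w                        ≡⟨ sym (+-identityʳ w) ⟩
  w + 0ℚ                   ≡⟨ cong (λ z → w + z) (sym (clear⇒carry≡0 (m ∸ 1) h T (clear-pred m T cl))) ⟩
  w + carry (m ∸ 1) h T    ∎
  where open ≤-Reasoning

weak-duality-from : ∀ Δ {n} μ h (xs : Vec ℚ n) (T : Subset n) → Separated Δ T →
  gain μ T xs ≤ total (greedyGo Δ μ h xs) + carry (Δ ∸ 1) h T
weak-duality-from Δ μ h [] [] _ = ≤-refl
weak-duality-from Δ μ h (x ∷ xs) (true ∷ T) (cl , sep) = begin
  (x - μ) + gain μ T xs
    ≡⟨ cong (_+ gain μ T xs) (solve 3 (λ x μ s → x :- μ := (x :- (μ :+ s)) :+ s) refl x μ s) ⟩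
  ((x - (μ + s)) + s) + gain μ T xs
    ≤⟨ +-mono-≤ (+-monoˡ-≤ s (p≤q⊔p 0ℚ (x - (μ + s)))) (weak-duality-from Δ μ (w ∷ h) xs T sep) ⟩
  (w + s) + (rest + carry (Δ ∸ 1) (w ∷ h) T)
    ≡⟨ cong (λ z → (w + s) + (rest + z)) (clear⇒carry≡0 (Δ ∸ 1) (w ∷ h) T cl) ⟩
  (w + s) + (rest + 0ℚ)
    ≡⟨ solve 3 (λ w s r → (w :+ s) :+ (r :+ con 0ℚ) := (w :+ r) :+ s) refl w s rest ⟩
  (w + rest) + s ∎
  where
    open ≤-Reasoning
    s : ℚ
    s = window Δ h
    w : ℚ
    w = next Δ μ h x
    rest : ℚ
    rest = total (greedyGo Δ μ (w ∷ h) xs)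
weak-duality-from Δ μ h (x ∷ xs) (false ∷ T) sep = begin
  gain μ T xs
    ≤⟨ weak-duality-from Δ μ (w ∷ h) xs T sep ⟩
  rest + carry (Δ ∸ 1) (w ∷ h) T
    ≤⟨ +-monoʳ-≤ rest (carry-push-≤ (Δ ∸ 1) w h T (p≤p⊔q 0ℚ (x - (μ + window Δ h)))) ⟩
  rest + (w + carry (Δ ∸ 1 ∸ 1) h T)
    ≡⟨ solve 3 (λ w p r → r :+ (w :+ p) := (w :+ r) :+ p) refl w (carry (Δ ∸ 1 ∸ 1) h T) rest ⟩
  (w + rest) + carry (Δ ∸ 1 ∸ 1) h T ∎
  where
    open ≤-Reasoning
    w : ℚ
    w = next Δ μ h x
    rest : ℚ
    rest = total (greedyGo Δ μ (w ∷ h) xs)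

-- A position is selected exactly when it is clear of the previously selected
-- window and its reduced value x - (μ + window) is nonnegative.
strong-duality-from : ∀ Δ {n} μ h (xs : Vec ℚ n) →
  Σ (Subset n) λ T → Separated Δ T × (gain μ T xs ≡ total (greedyGo Δ μ h xs) + carry (Δ ∸ 1) h T)
strong-duality-from Δ μ h [] = [] , tt , refl
strong-duality-from Δ μ h (x ∷ xs)
  with strong-duality-from Δ μ (next Δ μ h x ∷ h) xs
... | T , sep , eq with carry-push (Δ ∸ 1) (next Δ μ h x) h T
...   | inj₂ pushed = false ∷ T , sep , (begin
  gain μ T xs                            ≡⟨ eq ⟩
  rest + carry (Δ ∸ 1) (w ∷ h) T         ≡⟨ cong (λ z → rest + z) pushed ⟩
  rest + (w + carry (Δ ∸ 1 ∸ 1) h T)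
    ≡⟨ solve 3 (λ w p r → r :+ (w :+ p) := (w :+ r) :+ p) refl w (carry (Δ ∸ 1 ∸ 1) h T) rest ⟩
  (w + rest) + carry (Δ ∸ 1 ∸ 1) h T     ∎)
  where
    open ≡-Reasoning
    w : ℚ
    w = next Δ μ h x
    rest : ℚ
    rest = total (greedyGo Δ μ (w ∷ h) xs)
...   | inj₁ (cl , carry≡0) with ≤-total 0ℚ (x - (μ + window Δ h))
...     | inj₁ reduced≥0 = true ∷ T , (cl , sep) , (begin
  (x - μ) + gain μ T xs          ≡⟨ cong (λ z → (x - μ) + z) (trans eq (cong (λ z → rest + z) (carry≡0 (w ∷ h)))) ⟩
  (x - μ) + (rest + 0ℚ)
    ≡⟨ solve 4 (λ x μ s r → (x :- μ) :+ (r :+ con 0ℚ) := ((x :- (μ :+ s)) :+ r) :+ s) refl x μ s rest ⟩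
  ((x - (μ + s)) + rest) + s     ≡⟨ cong (λ z → (z + rest) + s) (sym (p≤q⇒p⊔q≡q reduced≥0)) ⟩
  (w + rest) + s                 ∎)
  where
    open ≡-Reasoning
    s : ℚ
    s = window Δ h
    w : ℚ
    w = next Δ μ h x
    rest : ℚ
    rest = total (greedyGo Δ μ (w ∷ h) xs)
...     | inj₂ reduced≤0 = false ∷ T , sep , (begin
  gain μ T xs          ≡⟨ trans eq (cong (λ z → rest + z) (carry≡0 (w ∷ h))) ⟩
  rest + 0ℚ            ≡⟨ solve 1 (λ r → r :+ con 0ℚ := (con 0ℚ :+ r) :+ con 0ℚ) refl rest ⟩
  (0ℚ + rest) + 0ℚ
    ≡⟨ cong₂ (λ a b → (a + rest) + b) (sym (p≥q⇒p⊔q≡p reduced≤0))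
             (sym (clear⇒carry≡0 (Δ ∸ 1 ∸ 1) h T (clear-pred (Δ ∸ 1) T cl))) ⟩
  (w + rest) + carry (Δ ∸ 1 ∸ 1) h T ∎)
  where
    open ≡-Reasoning
    w : ℚ
    w = next Δ μ h x
    rest : ℚ
    rest = total (greedyGo Δ μ (w ∷ h) xs)

dualValue : ℕ → ∀ {n} → ℚ → Vec ℚ n → ℚ
dualValue Δ μ xs = total (greedyGo Δ μ [] xs)

weak-duality : ∀ Δ {n} μ (xs : Vec ℚ n) (T : Subset n) → Separated Δ T →
  gain μ T xs ≤ dualValue Δ μ xs
weak-duality Δ μ xs T sep =
  subst (gain μ T xs ≤_) (trans (cong (λ z → dualValue Δ μ xs + z) (carry-[] (Δ ∸ 1) T)) (+-identityʳ _))
        (weak-duality-from Δ μ [] xs T sep)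

strong-duality : ∀ Δ {n} μ (xs : Vec ℚ n) →
  Σ (Subset n) λ P → Separated Δ P × gain μ P xs ≡ dualValue Δ μ xs
strong-duality Δ μ xs with strong-duality-from Δ μ [] xs
... | P , sep , eq =
  P , sep , trans eq (trans (cong (λ z → dualValue Δ μ xs + z) (carry-[] (Δ ∸ 1) P)) (+-identityʳ _))

-- A gap of Δ is a gap of 1 + (Δ - 1), also for Δ = 0.
≤-suc-pred : ∀ m → m ℕ.≤ suc (m ∸ 1)
≤-suc-pred zero = ℕ.z≤n
≤-suc-pred (suc m) = ℕP.≤-refl

clear⇒bound : ∀ {n} m (T : Subset n) → Clear m T → ∀ j → j ∈ T → m ℕ.≤ toℕ j
clear⇒bound zero T _ j _ = ℕ.z≤n
clear⇒bound (suc m) (false ∷ T) cl (suc j) (there j∈T) = ℕ.s≤s (clear⇒bound m T cl j j∈T)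

bound⇒clear : ∀ {n} m (T : Subset n) → (∀ j → j ∈ T → m ℕ.≤ toℕ j) → Clear m T
bound⇒clear zero T _ = tt
bound⇒clear (suc m) [] _ = tt
bound⇒clear (suc m) (true ∷ T) bound with bound zero here
... | ()
bound⇒clear (suc m) (false ∷ T) bound =
  bound⇒clear m T (λ j j∈T → ℕP.≤-pred (bound (suc j) (there j∈T)))

separated⇒InM : ∀ Δ {n} (T : Subset n) → Separated Δ T → InM Δ T
separated⇒InM Δ (true ∷ T) _ zero zero here here i≢j = ⊥-elim (i≢j refl)
separated⇒InM Δ (true ∷ T) (cl , _) zero (suc j) here (there j∈T) _ =
  ℕP.≤-trans (≤-suc-pred Δ) (ℕ.s≤s (clear⇒bound (Δ ∸ 1) T cl j j∈T))
separated⇒InM Δ (true ∷ T) (cl , _) (suc i) zero (there i∈T) here _ =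
  ℕP.≤-trans (≤-suc-pred Δ) (ℕ.s≤s (clear⇒bound (Δ ∸ 1) T cl i i∈T))
separated⇒InM Δ (true ∷ T) (_ , sep) (suc i) (suc j) (there i∈T) (there j∈T) i≢j =
  separated⇒InM Δ T sep i j i∈T j∈T (λ i≡j → i≢j (cong suc i≡j))
separated⇒InM Δ (false ∷ T) sep (suc i) (suc j) (there i∈T) (there j∈T) i≢j =
  separated⇒InM Δ T sep i j i∈T j∈T (λ i≡j → i≢j (cong suc i≡j))

InM-tail : ∀ Δ {n} b (T : Subset n) → InM Δ (b ∷ T) → InM Δ T
InM-tail Δ b T inM i j i∈T j∈T i≢j =
  inM (suc i) (suc j) (there i∈T) (there j∈T) (λ si≡sj → i≢j (FinP.suc-injective si≡sj))

InM⇒separated : ∀ Δ {n} (T : Subset n) → InM Δ T → Separated Δ T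
InM⇒separated Δ [] _ = tt
InM⇒separated Δ (true ∷ T) inM =
  bound⇒clear (Δ ∸ 1) T (λ j j∈T → ℕP.∸-monoˡ-≤ 1 (inM zero (suc j) here (there j∈T) (λ ())))
  , InM⇒separated Δ T (InM-tail Δ true T inM)
InM⇒separated Δ (false ∷ T) inM = InM⇒separated Δ T (InM-tail Δ false T inM)

asℚ : ∀ {n} → Vec ℤ n → Vec ℚ n
asℚ = Vec.map (_/ 1)

asℚ-int : ∀ {n} (c : Vec ℤ n) → All IsInt (asℚ c)
asℚ-int [] = []
asℚ-int (z ∷ c) = (z , /1≡ι z) ∷ asℚ-int c

sumOn≡gain : ∀ {n} μ (T : Subset n) (c : Vec ℤ n) → ι (sumOn T c) ≡ gain μ T (asℚ c) + μ * ι (+ ∣ T ∣)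
sumOn≡gain μ [] [] = trans (sym 0ℚ≡ι0) (0≡0+t*ι0 μ)
sumOn≡gain μ (true ∷ T) (a ∷ c) = begin
  ι (a ℤ.+ sumOn T c)             ≡⟨ sym (ι-+ a (sumOn T c)) ⟩
  ι a + ι (sumOn T c)             ≡⟨ cong (λ z → ι a + z) (sumOn≡gain μ T c) ⟩
  ι a + (G + μ * ι (+ ∣ T ∣))
    ≡⟨ solve 4 (λ a G μ t → a :+ (G :+ μ :* t) := (a :- μ) :+ G :+ μ :* (con 1ℚ :+ t)) refl (ι a) G μ (ι (+ ∣ T ∣)) ⟩
  (ι a - μ) + G + μ * (1ℚ + ι (+ ∣ T ∣))
    ≡⟨ cong₂ (λ u v → (u - μ) + G + μ * v) (sym (/1≡ι a)) (sym (ι-suc ∣ T ∣)) ⟩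
  (a / 1 - μ) + G + μ * ι (+ suc ∣ T ∣) ∎
  where
    open ≡-Reasoning
    G : ℚ
    G = gain μ T (asℚ c)
sumOn≡gain μ (false ∷ T) (a ∷ c) = sumOn≡gain μ T c

-- lagr k μ c T = gain μ T c + μ k: the Lagrangian and the gain have the same maximisers.
lagr≡gain : ∀ k {n} μ (c : Vec ℤ n) (T : Subset n) → lagr k μ c T ≡ gain μ T (asℚ c) + μ * ι (+ k)
lagr≡gain k μ c T = begin
  (sumOn T c / 1) + μ * ((+ k ℤ.- + ∣ T ∣) / 1)
    ≡⟨ cong₂ (λ u v → u + μ * v) (trans (/1≡ι _) (sumOn≡gain μ T c)) (trans (/1≡ι _) (ι-- (+ k) (+ ∣ T ∣))) ⟩
  (G + μ * ι (+ ∣ T ∣)) + μ * (ι (+ k) - ι (+ ∣ T ∣))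
    ≡⟨ solve 4 (λ G μ t k → (G :+ μ :* t) :+ μ :* (k :- t) := G :+ μ :* k) refl G μ (ι (+ ∣ T ∣)) (ι (+ k)) ⟩
  G + μ * ι (+ k) ∎
  where
    open ≡-Reasoning
    G : ℚ
    G = gain μ T (asℚ c)

gain-shift : ∀ {n} μ t (T : Subset n) (xs : Vec ℚ n) → gain (μ - t) T xs ≡ gain μ T xs + t * ι (+ ∣ T ∣)
gain-shift μ t [] [] = 0≡0+t*ι0 t
gain-shift μ t (true ∷ T) (x ∷ xs) = begin
  (x - (μ - t)) + gain (μ - t) T xs        ≡⟨ cong (λ z → (x - (μ - t)) + z) (gain-shift μ t T xs) ⟩
  (x - (μ - t)) + (G + t * ι (+ ∣ T ∣))
    ≡⟨ solve 5 (λ x μ t G n → (x :- (μ :- t)) :+ (G :+ t :* n) := ((x :- μ) :+ G) :+ t :* (con 1ℚ :+ n))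
             refl x μ t G (ι (+ ∣ T ∣)) ⟩
  ((x - μ) + G) + t * (1ℚ + ι (+ ∣ T ∣))   ≡⟨ cong (λ z → ((x - μ) + G) + t * z) (sym (ι-suc ∣ T ∣)) ⟩
  ((x - μ) + G) + t * ι (+ suc ∣ T ∣)      ∎
  where
    open ≡-Reasoning
    G : ℚ
    G = gain μ T xs
gain-shift μ t (false ∷ T) (x ∷ xs) = gain-shift μ t T xs

gain-int : ∀ {n} l (T : Subset n) (c : Vec ℤ n) → IsInt (gain (ι l) T (asℚ c))
gain-int l [] [] = + 0 , 0ℚ≡ι0
gain-int l (true ∷ T) (a ∷ c) =
  isInt-+ (isInt-- (a , /1≡ι a) (l , refl)) (gain-int l T c)
gain-int l (false ∷ T) (a ∷ c) = gain-int l T c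

length-filter-tabulate : ∀ {A : Set} {P : A → Set} (P? : Decidable P) {n} (f : Fin n → A) →
  length (filter P? (List.tabulate f)) ≡ length (filter (λ i → P? (f i)) (List.allFin n))
length-filter-tabulate P? {zero} f = refl
length-filter-tabulate P? {suc n} f
  with does (P? (f zero))
     | trans (length-filter-tabulate P? (λ i → f (suc i)))
             (sym (length-filter-tabulate (λ i → P? (f i)) suc))
... | true  | rest = cong suc rest
... | false | rest = rest

anyBump : ℕ → List Bool → Bool
anyBump zero _ = false
anyBump (suc m) [] = false
anyBump (suc m) (b ∷ fl) = b ∨ anyBump m fl

AtMostOneBump : ℕ → List Bool → Set
AtMostOneBump zero _ = ⊤
AtMostOneBump (suc m) [] = ⊤
AtMostOneBump (suc m) (true ∷ fl) = anyBump m fl ≡ false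
AtMostOneBump (suc m) (false ∷ fl) = AtMostOneBump m fl

noBump⇒atMostOne : ∀ m fl → anyBump m fl ≡ false → AtMostOneBump m fl
noBump⇒atMostOne zero fl _ = tt
noBump⇒atMostOne (suc m) [] _ = tt
noBump⇒atMostOne (suc m) (false ∷ fl) none = noBump⇒atMostOne m fl none

atMostOne-[] : ∀ m → AtMostOneBump m []
atMostOne-[] zero = tt
atMostOne-[] (suc m) = tt

noBump-pred : ∀ m fl → anyBump (suc m) fl ≡ false → anyBump m fl ≡ false
noBump-pred zero fl _ = refl
noBump-pred (suc m) [] _ = refl
noBump-pred (suc m) (false ∷ fl) none = noBump-pred m fl none

atMostOne-pred : ∀ m fl → AtMostOneBump (suc m) fl → AtMostOneBump m fl
atMostOne-pred zero fl _ = tt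
atMostOne-pred (suc m) [] _ = tt
atMostOne-pred (suc m) (true ∷ fl) none = noBump-pred m fl none
atMostOne-pred (suc m) (false ∷ fl) one = atMostOne-pred m fl one

atMostOne-push : ∀ m b fl → AtMostOneBump m fl → (b ≡ true → anyBump m fl ≡ false) →
  AtMostOneBump m (b ∷ fl)
atMostOne-push zero b fl _ _ = tt
atMostOne-push (suc m) true fl _ fresh = noBump-pred m fl (fresh refl)
atMostOne-push (suc m) false fl one _ = atMostOne-pred m fl one

-- Running the greedy at L - e instead of an integral L (0 < e < 1) raises
-- each coordinate by either 0 or e, and never raises two coordinates in one
-- window; hence the dual value rises by e times the number of active constraints.
module Perturbation (L e : ℚ) (L-int : IsInt L) (0<e : 0ℚ < e) (e<1 : e < 1ℚ) where

  bump : Bool → ℚ → ℚ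
  bump true q = q + e
  bump false q = q

  bump-≤ : ∀ b q → bump b q ≤ q + e
  bump-≤ true q = ≤-refl
  bump-≤ false q = ≤-+-nonNeg q (<⇒≤ 0<e)

  bump-nonNeg : ∀ b {q} → 0ℚ ≤ q → 0ℚ ≤ bump b q
  bump-nonNeg true {q} 0≤q = ≤-trans 0≤q (≤-+-nonNeg q (<⇒≤ 0<e))
  bump-nonNeg false 0≤q = 0≤q

  bump-+ : ∀ b q r → q + bump b r ≡ bump b (q + r)
  bump-+ true q r = sym (+-assoc q r e)
  bump-+ false q r = refl

  Tracks : List ℚ → List ℚ → List Bool → Set
  Tracks [] [] [] = ⊤
  Tracks (q ∷ h) (q′ ∷ h′) (b ∷ fl) = IsInt q × (q′ ≡ bump b q) × Tracks h h′ fl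
  Tracks _ _ _ = ⊥

  window-tracks : ∀ m h h′ fl → Tracks h h′ fl → AtMostOneBump m fl →
    IsInt (sumℚ (take m h)) × (sumℚ (take m h′) ≡ bump (anyBump m fl) (sumℚ (take m h)))
  window-tracks zero h h′ fl _ _ = (+ 0 , 0ℚ≡ι0) , refl
  window-tracks (suc m) [] [] [] _ _ = (+ 0 , 0ℚ≡ι0) , refl
  window-tracks (suc m) (q ∷ h) (q′ ∷ h′) (true ∷ fl) (q-int , refl , tr) none
    with window-tracks m h h′ fl tr (noBump⇒atMostOne m fl none)
  ... | s-int , eq = isInt-+ q-int s-int , (begin
    (q + e) + sumℚ (take m h′)                     ≡⟨ cong (λ z → (q + e) + z) eq ⟩
    (q + e) + bump (anyBump m fl) s                ≡⟨ cong (λ b → (q + e) + bump b s) none ⟩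
    (q + e) + s                                    ≡⟨ solve 3 (λ q e s → (q :+ e) :+ s := (q :+ s) :+ e) refl q e s ⟩
    (q + s) + e                                    ∎)
    where
      open ≡-Reasoning
      s : ℚ
      s = sumℚ (take m h)
  window-tracks (suc m) (q ∷ h) (q′ ∷ h′) (false ∷ fl) (q-int , refl , tr) one
    with window-tracks m h h′ fl tr one
  ... | s-int , eq =
    isInt-+ q-int s-int , trans (cong (λ z → q + z) eq) (bump-+ (anyBump m fl) q (sumℚ (take m h)))

  -- One greedy step: with reduced value D = x - (L + s) integral, the new
  -- coordinate is raised iff D ≥ 0 and the window load was not raised.
  greedy-step : ∀ x s a → IsInt x → IsInt s →
    Σ Bool λ b → IsInt (0ℚ ⊔ (x - (L + s))) ×
      (0ℚ ⊔ (x - ((L - e) + bump a s)) ≡ bump b (0ℚ ⊔ (x - (L + s)))) × (b ≡ true → a ≡ false)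
  greedy-step x s a x-int s-int = go (isInt-- x-int (isInt-+ L-int s-int)) (reduced′ a)
    where
      D : ℚ
      D = x - (L + s)
      reduced′ : ∀ a → x - ((L - e) + bump a s) ≡ bump (not a) D
      reduced′ true = solve 4 (λ x L e s → x :- ((L :- e) :+ (s :+ e)) := x :- (L :+ s)) refl x L e s
      reduced′ false = solve 4 (λ x L e s → x :- ((L :- e) :+ s) := (x :- (L :+ s)) :+ e) refl x L e s
      not-true : ∀ a → not a ≡ true → a ≡ false
      not-true false _ = refl
      go : IsInt D → x - ((L - e) + bump a s) ≡ bump (not a) D →
        Σ Bool λ b → IsInt (0ℚ ⊔ D) × (0ℚ ⊔ (x - ((L - e) + bump a s)) ≡ bump b (0ℚ ⊔ D)) × (b ≡ true → a ≡ false)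
      go (+ n , D≡n) eq = not a , (+ n , trans w≡D D≡n) , (begin
        0ℚ ⊔ (x - ((L - e) + bump a s))   ≡⟨ cong (0ℚ ⊔_) eq ⟩
        0ℚ ⊔ bump (not a) D               ≡⟨ p≤q⇒p⊔q≡q (bump-nonNeg (not a) 0≤D) ⟩
        bump (not a) D                    ≡⟨ cong (bump (not a)) (sym w≡D) ⟩
        bump (not a) (0ℚ ⊔ D)             ∎) , not-true a
        where
          open ≡-Reasoning
          0≤D : 0ℚ ≤ D
          0≤D = subst₂ _≤_ (sym 0ℚ≡ι0) (sym D≡n) (ι-mono-≤ (ℤ.+≤+ ℕ.z≤n))
          w≡D : 0ℚ ⊔ D ≡ D
          w≡D = p≤q⇒p⊔q≡q 0≤D
      go (-[1+ n ] , D≡-n) eq = false , (+ 0 , trans w≡0 0ℚ≡ι0) , (begin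
        0ℚ ⊔ (x - ((L - e) + bump a s))   ≡⟨ p≥q⇒p⊔q≡p (≤-trans (≤-reflexive eq) bumped≤0) ⟩
        0ℚ                                ≡⟨ sym w≡0 ⟩
        0ℚ ⊔ D                            ∎) , λ ()
        where
          open ≡-Reasoning
          D≤-1 : D ≤ ι -[1+ 0 ]
          D≤-1 = subst (_≤ ι -[1+ 0 ]) (sym D≡-n) (ι-mono-≤ (ℤ.-≤- ℕ.z≤n))
          w≡0 : 0ℚ ⊔ D ≡ 0ℚ
          w≡0 = p≥q⇒p⊔q≡p (≤-trans D≤-1 (subst (ι -[1+ 0 ] ≤_) (sym 0ℚ≡ι0) (ι-mono-≤ ℤ.-≤+)))
          bumped≤0 : bump (not a) D ≤ 0ℚ
          bumped≤0 = ≤-trans (bump-≤ (not a) D) (<⇒≤ (+-mono-≤-< D≤-1 e<1))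

  Perturbed : ∀ {n} → Vec ℚ n → Vec ℚ n → Set
  Perturbed [] [] = ⊤
  Perturbed (o ∷ os) (o′ ∷ os′) = IsInt o × (o′ ≡ o ⊎ o′ ≡ o + e) × Perturbed os os′

  bump⇒perturbed : ∀ b {o o′} → o′ ≡ bump b o → o′ ≡ o ⊎ o′ ≡ o + e
  bump⇒perturbed true eq = inj₂ eq
  bump⇒perturbed false eq = inj₁ eq

  perturbed-from : ∀ Δ {n} (xs : Vec ℚ n) → All IsInt xs → (h h′ : List ℚ) (fl : List Bool) →
    Tracks h h′ fl → AtMostOneBump (Δ ∸ 1) fl → Perturbed (greedyGo Δ L h xs) (greedyGo Δ (L - e) h′ xs)
  perturbed-from Δ [] [] h h′ fl _ _ = tt
  perturbed-from Δ (x ∷ xs) (x-int ∷ xs-int) h h′ fl tr one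
    with window-tracks (Δ ∸ 1) h h′ fl tr one
  ... | s-int , s′≡ with greedy-step x (window Δ h) (anyBump (Δ ∸ 1) fl) x-int s-int
  ... | b , w-int , w′≡ , fresh =
    w-int , bump⇒perturbed b w′≡′ ,
    perturbed-from Δ xs xs-int (next Δ L h x ∷ h) (next Δ (L - e) h′ x ∷ h′) (b ∷ fl)
      (w-int , w′≡′ , tr) (atMostOne-push (Δ ∸ 1) b fl one fresh)
    where
      w′≡′ : next Δ (L - e) h′ x ≡ bump b (next Δ L h x)
      w′≡′ = trans (cong (λ s′ → 0ℚ ⊔ (x - ((L - e) + s′))) s′≡) w′≡

  raised : ∀ {n} → Vec ℚ n → Vec ℚ n → ℕ
  raised {n} o o′ = length (filter (λ i → lookup o′ i ≟ (lookup o i + e)) (List.allFin n))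

  raised-cons : ∀ {n} o (os : Vec ℚ n) o′ os′ →
    raised (o ∷ os) (o′ ∷ os′) ≡ (if does (o′ ≟ (o + e)) then suc else (λ r → r)) (raised os os′)
  raised-cons o os o′ os′ with does (o′ ≟ (o + e))
  ... | true = cong suc (length-filter-tabulate (λ i → lookup (o′ ∷ os′) i ≟ (lookup (o ∷ os) i + e)) suc)
  ... | false = length-filter-tabulate (λ i → lookup (o′ ∷ os′) i ≟ (lookup (o ∷ os) i + e)) suc

  o≢o+e : ∀ o → o ≢ o + e
  o≢o+e o o≡o+e = <-irrefl o≡o+e (subst (_< o + e) (+-identityʳ o) (+-monoʳ-< o 0<e))

  total-perturbed : ∀ {n} (o o′ : Vec ℚ n) → Perturbed o o′ →
    IsInt (total o) × (total o′ ≡ total o + e * ι (+ raised o o′))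
  total-perturbed [] [] tt = (+ 0 , 0ℚ≡ι0) , 0≡0+t*ι0 e
  total-perturbed (o ∷ os) (o′ ∷ os′) (o-int , step , rest) with total-perturbed os os′ rest
  ... | S-int , eq rewrite raised-cons o os o′ os′ with step | o′ ≟ (o + e)
  ...   | inj₁ refl | yes o≡o+e = ⊥-elim (o≢o+e o o≡o+e)
  ...   | inj₂ refl | no o+e≢o+e = ⊥-elim (o+e≢o+e refl)
  ...   | inj₁ refl | no _ = isInt-+ o-int S-int , (begin
    o + total os′                        ≡⟨ cong (λ z → o + z) eq ⟩
    o + (total os + e * ι (+ r))         ≡⟨ sym (+-assoc o _ _) ⟩
    (o + total os) + e * ι (+ r)         ∎)
    where
      open ≡-Reasoning
      r : ℕ
      r = raised os os′
  ...   | inj₂ refl | yes _ = isInt-+ o-int S-int , (begin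
    (o + e) + total os′                  ≡⟨ cong (λ z → (o + e) + z) eq ⟩
    (o + e) + (S + e * ι (+ r))
      ≡⟨ solve 4 (λ o e S r → (o :+ e) :+ (S :+ e :* r) := (o :+ S) :+ e :* (con 1ℚ :+ r)) refl o e S (ι (+ r)) ⟩
    (o + S) + e * (1ℚ + ι (+ r))         ≡⟨ cong (λ z → (o + S) + e * z) (sym (ι-suc r)) ⟩
    (o + S) + e * ι (+ suc r)            ∎)
    where
      open ≡-Reasoning
      S : ℚ
      S = total os
      r : ℕ
      r = raised os os′

  perturbation : ∀ Δ {n} (c : Vec ℤ n) →
    IsInt (dualValue Δ L (asℚ c)) ×
    (dualValue Δ (L - e) (asℚ c) ≡ dualValue Δ L (asℚ c) + e * ι (+ activeCount Δ c L e))
  perturbation Δ c =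
    total-perturbed (greedyGo Δ L [] (asℚ c)) (greedyGo Δ (L - e) [] (asℚ c))
      (perturbed-from Δ (asℚ c) (asℚ-int c) [] [] [] tt (atMostOne-[] (Δ ∸ 1)))

-- An abstract LP-duality situation: supports T with integral objective at
-- L, a dual value bounding every feasible objective and attained by some
-- feasible support, and objectives moving linearly in μ with slope |T|.
module Squeeze
  {A : Set} (Feasible : A → Set) (objective : ℚ → A → ℚ) (size : A → ℚ) (dual : ℚ → ℚ)
  (weak : ∀ μ T → Feasible T → objective μ T ≤ dual μ)
  (strong : ∀ μ → Σ A λ P → Feasible P × objective μ P ≡ dual μ)
  (L : ℚ) (shift : ∀ t T → objective (L - t) T ≡ objective L T + t * size T)
  (objective-int : ∀ T → IsInt (objective L T)) (dual-int : IsInt (dual L))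
  where

  Fine : ℚ → Set
  Fine t = 0ℚ < t × (∀ T → t * size T < 1ℚ)

  attains : ∀ T {r} → Feasible T → r < 1ℚ → dual L ≤ objective L T + r → objective L T ≡ dual L
  attains T feas r<1 le = ≤-antisym (weak L T feas) (int-floor dual-int (objective-int T) r<1 le)

  pinned : ∀ K e t → 0ℚ ≤ K → Fine e → Fine t → dual (L - e) ≡ dual L + e * K →
    ∀ S → Feasible S → (∀ T → Feasible T → objective (L - t) T ≤ objective (L - t) S) → size S ≡ K
  pinned K e t 0≤K (0<e , e-fine) (0<t , t-fine) dual-rise S S-feas S-opt = ≤-antisym size≤K K≤size
    where
      P : A
      P = proj₁ (strong (L - e))
      P-feas : Feasible P
      P-feas = proj₁ (proj₂ (strong (L - e)))
      P-value : objective L P + e * size P ≡ dual L + e * K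
      P-value = trans (sym (shift e P)) (trans (proj₂ (proj₂ (strong (L - e)))) dual-rise)
      P-attains : objective L P ≡ dual L
      P-attains = attains P P-feas (e-fine P)
        (≤-trans (≤-+-nonNeg (dual L) (*-nonNeg 0<e 0≤K)) (≤-reflexive (sym P-value)))
      P-size : size P ≡ K
      P-size = ≤-antisym (+*-cancel-≤ (dual L) 0<e (≤-reflexive P-value′))
                         (+*-cancel-≤ (dual L) 0<e (≤-reflexive (sym P-value′)))
        where
          P-value′ : dual L + e * size P ≡ dual L + e * K
          P-value′ = trans (cong (_+ e * size P) (sym P-attains)) P-value
      S-beats-P : dual L + t * K ≤ objective L S + t * size S
      S-beats-P = subst₂ _≤_ (trans (shift t P) (cong₂ (λ a b → a + t * b) P-attains P-size))
                             (shift t S) (S-opt P P-feas)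
      S-attains : objective L S ≡ dual L
      S-attains = attains S S-feas (t-fine S)
        (≤-trans (≤-+-nonNeg (dual L) (*-nonNeg 0<t 0≤K)) S-beats-P)
      K≤size : K ≤ size S
      K≤size = +*-cancel-≤ (dual L) 0<t (subst (λ v → dual L + t * K ≤ v + t * size S) S-attains S-beats-P)
      size≤K : size S ≤ K
      size≤K = +*-cancel-≤ (dual L) 0<e (begin
        dual L + e * size S            ≡⟨ cong (_+ e * size S) (sym S-attains) ⟩
        objective L S + e * size S     ≡⟨ sym (shift e S) ⟩
        objective (L - e) S            ≤⟨ weak (L - e) S S-feas ⟩
        dual (L - e)                   ≡⟨ dual-rise ⟩
        dual L + e * K                 ∎)
        where open ≤-Reasoning

below-1/d : ∀ {d} .{{_ : NonZero d}} {t} → 0ℚ < t → t < (+ 1) / d → (T : Subset d) → t * ι (+ ∣ T ∣) < 1ℚ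
below-1/d {suc d′} {t} 0<t t<1/d T = begin-strict
  t * ι (+ ∣ T ∣)           ≤⟨ *-monoˡ-≤-nonNeg t {{nonNegative (<⇒≤ 0<t)}} (ι-mono-≤ (ℤ.+≤+ (∣p∣≤n T))) ⟩
  t * ι (+ d)               <⟨ *-monoˡ-<-pos (ι (+ d)) t<1/d ⟩
  ((+ 1) / d) * ι (+ d)     ≡⟨ cong (_* ι (+ d)) (normalize-coprime (Coprimality.1-coprimeTo d)) ⟩
  (1/ ι (+ d)) * ι (+ d)    ≡⟨ *-inverseˡ (ι (+ d)) ⟩
  1ℚ                        ∎
  where
    open ≤-Reasoning
    d = suc d′

1/d≤1 : ∀ {d} .{{_ : NonZero d}} → (+ 1) / d ≤ 1ℚ
1/d≤1 {suc d′} =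
  subst (_≤ 1ℚ) (sym (normalize-coprime (Coprimality.1-coprimeTo (suc d′)))) (*≤* (ℤ.+≤+ (ℕ.s≤s ℕ.z≤n)))

shrink : ∀ {ε δ} → 0ℚ < ε → ε < 1ℚ → 0ℚ < δ → δ ≤ 1ℚ → 0ℚ < ε * δ × ε * δ < δ × ε * δ ≤ ε
shrink {ε} {δ} 0<ε ε<1 0<δ δ≤1 =
  positive⁻¹ (ε * δ) {{pos*pos⇒pos ε {{positive 0<ε}} δ {{positive 0<δ}}}} ,
  subst (ε * δ <_) (*-identityˡ δ) (*-monoˡ-<-pos δ {{positive 0<δ}} ε<1) ,
  subst (ε * δ ≤_) (*-identityʳ ε) (*-monoˡ-≤-nonNeg ε {{nonNegative (<⇒≤ 0<ε)}} δ≤1)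

below-mono : ∀ {s t q} → 0ℚ ≤ q → s ≤ t → t * q < 1ℚ → s * q < 1ℚ
below-mono {q = q} 0≤q s≤t tq<1 = ≤-<-trans (*-monoʳ-≤-nonNeg q {{nonNegative 0≤q}} s≤t) tq<1

lagr-max⇒gain-max : ∀ Δ k {n} μ (c : Vec ℤ n) (S : Subset n) →
  ((T : Subset n) → InM Δ T → lagr k μ c T ≤ lagr k μ c S) →
  ∀ T → Separated Δ T → gain μ T (asℚ c) ≤ gain μ S (asℚ c)
lagr-max⇒gain-max Δ k μ c S S-max T T-sep =
  +-cancelˡ-≤ (μ * ι (+ k)) (subst₂ _≤_ (lagr≡gain′ T) (lagr≡gain′ S) (S-max T (separated⇒InM Δ T T-sep)))
  where
    lagr≡gain′ : ∀ U → lagr k μ c U ≡ μ * ι (+ k) + gain μ U (asℚ c)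
    lagr≡gain′ U = trans (lagr≡gain k μ c U) (+-comm (gain μ U (asℚ c)) (μ * ι (+ k)))

ι-injective-ℕ : ∀ {m n} → ι (+ m) ≡ ι (+ n) → m ≡ n
ι-injective-ℕ eq = ℤP.+-injective (cong ↥_ eq)

lemma7 : (Δ k d : ℕ) → Δ ≥ 1 → k ≥ 1 → .{{_ : NonZero d}} →
    (c : Vec ℤ d) (λ₀ : ℤ) →
    Σ ℚ (λ δ → (0ℚ < δ) × (δ ≤ 1ℚ) ×
      ((ε′ : ℚ) → 0ℚ < ε′ → ε′ < δ → activeCount Δ c (λ₀ / 1) ε′ ≡ k)) →
    (ε : ℚ) → 0ℚ < ε → ε < (+ 1) / d →
    (S : Subset d) → InProjLagr Δ k ((λ₀ / 1) - ε) c S → ∣ S ∣ ≡ k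
lemma7 Δ k d _ _ c λ₀ (δ , 0<δ , δ≤1 , active≡k) ε 0<ε ε<1/d S (S-inM , S-max) =
  ι-injective-ℕ (pinned (ι (+ k)) e ε (ι-nonNeg k) (0<e , e-fine) (0<ε , below-1/d 0<ε ε<1/d)
                        dual-rise S (InM⇒separated Δ S S-inM) (lagr-max⇒gain-max Δ k (L - ε) c S S-max))
  where
    L : ℚ
    L = λ₀ / 1
    xs : Vec ℚ d
    xs = asℚ c
    -- The perturbation e = εδ lies below δ and is at most ε.
    e : ℚ
    e = ε * δ
    e-bounds : 0ℚ < e × e < δ × e ≤ ε
    e-bounds = shrink 0<ε (<-≤-trans ε<1/d 1/d≤1) 0<δ δ≤1
    0<e : 0ℚ < e
    0<e = proj₁ e-bounds
    e<δ : e < δ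
    e<δ = proj₁ (proj₂ e-bounds)
    e-fine : ∀ T → e * ι (+ ∣ T ∣) < 1ℚ
    e-fine T = below-mono (ι-nonNeg ∣ T ∣) (proj₂ (proj₂ e-bounds)) (below-1/d 0<ε ε<1/d T)
    gain-int-L : ∀ T → IsInt (gain L T xs)
    gain-int-L T = subst (λ μ → IsInt (gain μ T xs)) (sym (/1≡ι λ₀)) (gain-int λ₀ T c)
    open Perturbation L e (λ₀ , /1≡ι λ₀) 0<e (<-≤-trans e<δ δ≤1) using (perturbation)
    dual-rise : dualValue Δ (L - e) xs ≡ dualValue Δ L xs + e * ι (+ k)
    dual-rise = trans (proj₂ (perturbation Δ c))
                      (cong (λ a → dualValue Δ L xs + e * ι (+ a)) (active≡k e 0<e e<δ))
    open Squeeze (Separated Δ) (λ μ T → gain μ T xs) (λ T → ι (+ ∣ T ∣)) (λ μ → dualValue Δ μ xs)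
      (λ μ T → weak-duality Δ μ xs T) (λ μ → strong-duality Δ μ xs)
      L (λ t T → gain-shift L t T xs) gain-int-L (proj₁ (perturbation Δ c))
      using (pinned)
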